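{- Let $G$ be a finite simple connected graph and let $H$, $H'$ be two distance-balanced finite simple connected graphs of the same order. Then $G\wr H$ is distance-balanced if and only if $G\wr H'$ is distance-balanced.
   Context: A graph $K$ is distance-balanced if for every edge $uv$, $|\{z:d_K(z,u)<d_K(z,v)\}|=|\{z:d_K(z,v)<d_K(z,u)\}|$, with $d_K$ the geodesic distance. With $V_G=\{x_1,\dots,x_n\}$, the wreath product $G\wr H$ has vertex set $\{(y_1,\dots,y_n)x_i: y_j\in V_H, x_i\in V_G\}$, with $(y_1,\dots,y_n)x_i\sim(y'_1,\dots,y'_n)x_k$ iff either ($i=k$, $y_j=y'_j$ for $j\ne i$, $y_i\sim y'_i$ in $H$) or ($y_j=y'_j$ for all $j$ and $x_i\sim x_k$ in $G$). -}

module Defs where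

open import Data.Bool using (Bool; true; false; _∧_; _∨_; if_then_else_)
open import Data.Nat using (ℕ; zero; suc; _<ᵇ_)
open import Data.Fin using (Fin)
open import Data.Fin.Properties using () renaming (_≟_ to _≟F_)
open import Data.Vec using (Vec; []; _∷_; lookup; _[_]≔_)
import Data.Vec.Properties as VP
open import Data.List using (List; []; _∷_; [_]; map; concatMap; length; filterᵇ; allFin; cartesianProduct)
open import Data.Bool.ListAction using (any)
open import Data.List.Membership.Propositional using (_∈_)
open import Data.List.Relation.Unary.Unique.Propositional using (Unique)
open import Data.Product using (_×_; _,_; ∃)
open import Relation.Binary.PropositionalEquality using (_≡_)
open import Relation.Binary.Definitions using (DecidableEquality)
open import Relation.Nullary.Decidable using (⌊_⌋)
open import Relation.Nullary using (¬_)

record Graph : Set₁ where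
  field
    V     : Set
    _≟V_  : DecidableEquality V
    verts : List V
    adj   : V → V → Bool

module _ (K : Graph) where
  open Graph K

  IsFinite : Set
  IsFinite = (∀ v → v ∈ verts) × Unique verts

  IsSimple : Set
  IsSimple = (∀ u v → adj u v ≡ adj v u) × (∀ v → adj v v ≡ false)

  data Walk : V → V → ℕ → Set where
    here : ∀ {u} → Walk u u 0
    step : ∀ {u v w k} → Walk u v k → adj v w ≡ true → Walk u w (suc k)

  IsConnected : Set
  IsConnected = ∀ u v → ∃ λ k → Walk u v k

  reach : ℕ → V → V → Bool
  reach zero    u v = ⌊ u ≟V v ⌋
  reach (suc k) u v = reach k u v ∨ any (λ w → reach k u w ∧ adj w v) verts

  private
    search : V → V → ℕ → ℕ → ℕ
    search u v k zero    = k
    search u v k (suc f) = if reach k u v then k else search u v (suc k) f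

  -- geodesic distance (correct for finite connected graphs, where the
  -- distance is < the number of vertices)
  dist : V → V → ℕ
  dist u v = search u v 0 (length verts)

  count : (V → Bool) → ℕ
  count p = length (filterᵇ p verts)

  DistanceBalanced : Set
  DistanceBalanced = ∀ u v → adj u v ≡ true →
    count (λ z → dist z u <ᵇ dist z v) ≡ count (λ z → dist z v <ᵇ dist z u)

record FinGraph (n : ℕ) : Set where
  field
    adjF : Fin n → Fin n → Bool

toGraph : ∀ {n} → FinGraph n → Graph
toGraph {n} G = record
  { V = Fin n ; _≟V_ = _≟F_ ; verts = allFin n ; adj = FinGraph.adjF G }

allVecs : ∀ n m → List (Vec (Fin m) n)
allVecs zero    m = [ [] ]
allVecs (suc n) m = concatMap (λ y → map (y ∷_) (allVecs n m)) (allFin m)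

-- wreath product G ≀ H, vertices (y_1,…,y_n) x_i
wreath : ∀ {n m} → FinGraph n → FinGraph m → Graph
wreath {n} {m} G H = record
  { V     = Vec (Fin m) n × Fin n
  ; _≟V_  = VP.≡-dec _≟F_ ×-≟ _≟F_
  ; verts = cartesianProduct (allVecs n m) (allFin n)
  ; adj   = λ { (ys , i) (ys' , k) →
      (⌊ i ≟F k ⌋ ∧ ⌊ VP.≡-dec _≟F_ ys' (ys [ i ]≔ lookup ys' i) ⌋
                 ∧ FinGraph.adjF H (lookup ys i) (lookup ys' i))
      ∨ (⌊ VP.≡-dec _≟F_ ys ys' ⌋ ∧ FinGraph.adjF G i k) }
  }
  where open import Data.Product.Properties using () renaming (≡-dec to ×-dec)
        _×-≟_ = ×-dec

{-# OPTIONS --safe #-}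

-- Distances in G ≀ H split as d((x , l) , (y , i)) = T + Σⱼ d_H(xⱼ , yⱼ), where T is the length of
-- a shortest walk in G from l to i through every j with xⱼ ≠ yⱼ: a walk in G ≀ H projects to such a
-- base walk and spends at least d_H(xⱼ , yⱼ) steps in the fibres over each j, and conversely such a
-- base walk lifts by inserting fibre geodesics. The tour term T does not depend on H.
-- Across a base edge (y , i)(y , k) the fibre term is the same at both ends, so which end is closer
-- to a vertex is decided by T alone, identically for H and H′ (equal orders give equal vertex sets).
-- Across a fibre edge (y , i)(y′ , i) the tour term is the same at both ends, so (x , l) is closer
-- to the end whose i-th coordinate is closer to xᵢ in H; summing over all (x , l) multiplies the
-- two counts of the edge yᵢ y′ᵢ of H by a common factor, and these agree since H is
-- distance-balanced.

module Submission where

open import Data.Bool using (Bool; true; false; T; T?; if_then_else_; _∧_; _∨_)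
open import Data.Bool.ListAction using (or)
open import Data.Bool.Properties using (T-≡; T-∧; T-∨; ∨-zeroʳ)
open import Data.Empty using (⊥-elim)
open import Data.Fin using (Fin; zero; suc; _≟_)
open import Data.List using (List; []; _∷_; _++_; map; length; filterᵇ; concatMap; cartesianProductWith; allFin)
open import Data.List.Membership.Propositional using (_∈_; lose)
open import Data.List.Membership.Propositional.Properties using (∈-allFin; ∈-cartesianProduct⁺; ∈-cartesianProductWith⁺)
open import Data.List.Properties using (length-++; length-filter; filter-++; filter-some; map-cong)
open import Data.List.Relation.Unary.All as All using (All; []; _∷_)
open import Data.List.Relation.Unary.Any using (here; satisfied)
open import Data.List.Relation.Unary.Any.Properties using (any⁺; any⁻)
open import Data.Nat using (ℕ; zero; suc; _<ᵇ_; _+_; _*_; _≤_; _<_; z≤n; s≤s; _≤′_; ≤′-refl; ≤′-step)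
open import Data.Nat.Properties hiding (_≟_)
open import Algebra.Properties.CommutativeSemigroup +-commutativeSemigroup using (x∙yz≈y∙xz; xy∙z≈xz∙y)
open import Data.Product using (Σ; _×_; _,_; ∃; proj₁; proj₂)
open import Data.Sum as Sum using (_⊎_; inj₁; inj₂)
open import Data.Vec using (Vec; []; _∷_; lookup; tabulate; _[_]≔_)
open import Data.Vec.Properties
  using (≡-dec; lookup∘update; lookup∘update′; []≔-lookup; []≔-idempotent; tabulate∘lookup; tabulate-cong)
open import Function using (_∘_; id)
open import Function.Bundles using (Equivalence; _⇔_; mk⇔)
open import Relation.Binary.PropositionalEquality
open import Relation.Nullary using (Dec; yes; no)
open import Relation.Nullary.Decidable using (⌊_⌋; toWitness; fromWitness; decidable-stable)
open import Relation.Nullary.Reflects using (det; fromEquivalence)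

open import Defs

open Equivalence using (to; from)

private
  variable
    A B C : Set

countᵇ : (A → Bool) → List A → ℕ
countᵇ p xs = length (filterᵇ p xs)

countᵇ-cong : ∀ {p q : A → Bool} xs → (∀ x → p x ≡ q x) → countᵇ p xs ≡ countᵇ q xs
countᵇ-cong [] _ = refl
countᵇ-cong {p = p} {q} (x ∷ xs) p≗q with p x | q x | p≗q x
... | true  | true  | refl = cong suc (countᵇ-cong xs p≗q)
... | false | false | refl = countᵇ-cong xs p≗q

countᵇ-≤-length : ∀ (p : A → Bool) xs → countᵇ p xs ≤ length xs
countᵇ-≤-length p = length-filter (T? ∘ p)

countᵇ-pos : ∀ (p : A → Bool) {x xs} → x ∈ xs → T (p x) → 0 < countᵇ p xs
countᵇ-pos p x∈xs px = filter-some (T? ∘ p) (lose x∈xs px)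

countᵇ-mono : ∀ {p q : A → Bool} xs → (∀ x → T (p x) → T (q x)) → countᵇ p xs ≤ countᵇ q xs
countᵇ-mono [] _ = z≤n
countᵇ-mono {p = p} {q} (x ∷ xs) p⇒q with p x in px | q x in qx
... | true  | false = ⊥-elim (subst T qx (p⇒q x (subst T (sym px) _)))
... | true  | true  = s≤s (countᵇ-mono xs p⇒q)
... | false | true  = m≤n⇒m≤1+n (countᵇ-mono xs p⇒q)
... | false | false = countᵇ-mono xs p⇒q

countᵇ-grows : ∀ {p q : A → Bool} xs → (∀ x → T (p x) → T (q x)) →
  All (λ x → p x ≡ q x) xs ⊎ countᵇ p xs < countᵇ q xs
countᵇ-grows [] _ = inj₁ []
countᵇ-grows {p = p} {q} (x ∷ xs) p⇒q with p x in px | q x in qx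
... | true  | false = ⊥-elim (subst T qx (p⇒q x (subst T (sym px) _)))
... | false | true  = inj₂ (s≤s (countᵇ-mono xs p⇒q))
... | true  | true  = Sum.map (trans px (sym qx) ∷_) s≤s (countᵇ-grows xs p⇒q)
... | false | false = Sum.map (trans px (sym qx) ∷_) id (countᵇ-grows xs p⇒q)

countᵇ-++ : ∀ (p : A → Bool) xs ys → countᵇ p (xs ++ ys) ≡ countᵇ p xs + countᵇ p ys
countᵇ-++ p xs ys = trans (cong length (filter-++ (T? ∘ p) xs ys)) (length-++ (filterᵇ p xs))

countᵇ-map : ∀ (p : B → Bool) (f : A → B) xs → countᵇ p (map f xs) ≡ countᵇ (p ∘ f) xs
countᵇ-map p f [] = refl
countᵇ-map p f (x ∷ xs) with p (f x)
... | true  = cong suc (countᵇ-map p f xs)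
... | false = countᵇ-map p f xs

countᵇ-const : ∀ b (xs : List A) → countᵇ (λ _ → b) xs ≡ (if b then length xs else 0)
countᵇ-const true  []       = refl
countᵇ-const false []       = refl
countᵇ-const true  (_ ∷ xs) = cong suc (countᵇ-const true xs)
countᵇ-const false (_ ∷ xs) = countᵇ-const false xs

module _ (f : A → B → C) (p : C → Bool) where

  countᵇ-cartesianProductWith-fst : ∀ (r : A → Bool) xs ys → (∀ x y → p (f x y) ≡ r x) →
    countᵇ p (cartesianProductWith f xs ys) ≡ countᵇ r xs * length ys
  countᵇ-cartesianProductWith-fst r []       ys _   = refl
  countᵇ-cartesianProductWith-fst r (x ∷ xs) ys p≗r = begin
    countᵇ p (map (f x) ys ++ cartesianProductWith f xs ys)
      ≡⟨ countᵇ-++ p (map (f x) ys) _ ⟩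
    countᵇ p (map (f x) ys) + countᵇ p (cartesianProductWith f xs ys)
      ≡⟨ cong₂ _+_ (trans (countᵇ-map p (f x) ys) (countᵇ-cong ys (p≗r x)))
                   (countᵇ-cartesianProductWith-fst r xs ys p≗r) ⟩
    countᵇ (λ _ → r x) ys + countᵇ r xs * length ys
      ≡⟨ row ⟩
    countᵇ r (x ∷ xs) * length ys ∎
    where
    open ≡-Reasoning
    row : countᵇ (λ _ → r x) ys + countᵇ r xs * length ys ≡ countᵇ r (x ∷ xs) * length ys
    row with r x
    ... | true  = cong (_+ countᵇ r xs * length ys) (countᵇ-const true ys)
    ... | false = cong (_+ countᵇ r xs * length ys) (countᵇ-const false ys)

  countᵇ-cartesianProductWith-snd : ∀ (r : B → Bool) xs ys → (∀ x y → p (f x y) ≡ r y) →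
    countᵇ p (cartesianProductWith f xs ys) ≡ length xs * countᵇ r ys
  countᵇ-cartesianProductWith-snd r []       ys _   = refl
  countᵇ-cartesianProductWith-snd r (x ∷ xs) ys p≗r = begin
    countᵇ p (map (f x) ys ++ cartesianProductWith f xs ys)
      ≡⟨ countᵇ-++ p (map (f x) ys) _ ⟩
    countᵇ p (map (f x) ys) + countᵇ p (cartesianProductWith f xs ys)
      ≡⟨ cong₂ _+_ (trans (countᵇ-map p (f x) ys) (countᵇ-cong ys (p≗r x)))
                   (countᵇ-cartesianProductWith-snd r xs ys p≗r) ⟩
    countᵇ r ys + length xs * countᵇ r ys ∎
    where open ≡-Reasoning

concatMap-map≡cartesianProductWith : ∀ (f : A → B → C) xs ys →
  concatMap (λ x → map (f x) ys) xs ≡ cartesianProductWith f xs ys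
concatMap-map≡cartesianProductWith f []       ys = refl
concatMap-map≡cartesianProductWith f (x ∷ xs) ys =
  cong (map (f x) ys ++_) (concatMap-map≡cartesianProductWith f xs ys)

<ᵇ-cong : ∀ a b c d → (a < b ⇔ c < d) → (a <ᵇ b) ≡ (c <ᵇ d)
<ᵇ-cong a b c d a<b⇔c<d =
  det (<ᵇ-reflects-< a b) (fromEquivalence (from a<b⇔c<d ∘ <ᵇ⇒< c d) (<⇒<ᵇ ∘ to a<b⇔c<d))

<-offset : ∀ {a b a′ b′} c d → a + d ≡ a′ + c → b + d ≡ b′ + c → a < b ⇔ a′ < b′
<-offset {a} {b} {a′} {b′} c d ad≡a′c bd≡b′c = mk⇔
  (λ a<b → +-cancelʳ-< c a′ b′ (subst₂ _<_ ad≡a′c bd≡b′c (+-monoˡ-< d a<b)))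
  (λ a′<b′ → +-cancelʳ-< d a b (subst₂ _<_ (sym ad≡a′c) (sym bd≡b′c) (+-monoˡ-< c a′<b′)))

<-exchange : ∀ {a b c d} → a + d ≡ b + c → a < b ⇔ c < d
<-exchange {a} {b} {c} {d} ad≡bc = mk⇔
  (λ a<b → +-cancelˡ-< b c d (subst (_< b + d) ad≡bc (+-monoˡ-< d a<b)))
  (λ c<d → +-cancelʳ-< d a b (subst (_< b + d) (sym ad≡bc) (+-monoʳ-< b c<d)))

AgreeOff : ∀ {n} → Fin n → Vec A n → Vec A n → Set
AgreeOff i x y = ∀ j → j ≢ i → lookup x j ≡ lookup y j

agreeOff-[]≔ : ∀ {n} (i : Fin n) (x : Vec A n) c → AgreeOff i x (x [ i ]≔ c)
agreeOff-[]≔ i x c j j≢i = sym (lookup∘update′ j≢i x c)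

agreeOff⇒[]≔-lookup : ∀ {n} i (x y : Vec A n) → AgreeOff i x y → x [ i ]≔ lookup y i ≡ y
agreeOff⇒[]≔-lookup i x y x≈y = begin
  x [ i ]≔ lookup y i                     ≡⟨ tabulate∘lookup _ ⟨
  tabulate (lookup (x [ i ]≔ lookup y i)) ≡⟨ tabulate-cong pointwise ⟩
  tabulate (lookup y)                     ≡⟨ tabulate∘lookup y ⟩
  y                                       ∎
  where
  open ≡-Reasoning
  pointwise : ∀ j → lookup (x [ i ]≔ lookup y i) j ≡ lookup y j
  pointwise j with j ≟ i
  ... | yes refl = lookup∘update i x (lookup y i)
  ... | no j≢i   = trans (lookup∘update′ j≢i x _) (x≈y j j≢i)

module SumDist (d : A → A → ℕ) (d-refl : ∀ a → d a a ≡ 0) where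

  sumDist : ∀ {n} → Vec A n → Vec A n → ℕ
  sumDist []      []      = 0
  sumDist (a ∷ x) (b ∷ y) = d a b + sumDist x y

  sumDist-refl : ∀ {n} (x : Vec A n) → sumDist x x ≡ 0
  sumDist-refl []      = refl
  sumDist-refl (a ∷ x) rewrite d-refl a | sumDist-refl x = refl

  sumDist-[]≔ : ∀ {n} (x y : Vec A n) i c →
    sumDist x (y [ i ]≔ c) ≡ sumDist x (y [ i ]≔ lookup x i) + d (lookup x i) c
  sumDist-[]≔ (a ∷ x) (b ∷ y) zero    c rewrite d-refl a = +-comm (d a c) (sumDist x y)
  sumDist-[]≔ (a ∷ x) (b ∷ y) (suc i) c rewrite sumDist-[]≔ x y i c = sym (+-assoc (d a b) _ _)

  sumDist-split : ∀ {n} (x y : Vec A n) i →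
    sumDist x y ≡ sumDist x (y [ i ]≔ lookup x i) + d (lookup x i) (lookup y i)
  sumDist-split x y i = trans (cong (sumDist x) (sym ([]≔-lookup y i))) (sumDist-[]≔ x y i (lookup y i))

  sumDist-agreeOff : ∀ {n} (x y : Vec A n) i → AgreeOff i x y → sumDist x y ≡ d (lookup x i) (lookup y i)
  sumDist-agreeOff x y i x≈y = begin
    sumDist x y                          ≡⟨ sumDist-split x y i ⟩
    sumDist x (y [ i ]≔ lookup x i) + dᵢ ≡⟨ cong (λ z → sumDist x z + dᵢ) y[i]≔xᵢ≡x ⟩
    sumDist x x + dᵢ                     ≡⟨ cong (_+ dᵢ) (sumDist-refl x) ⟩
    dᵢ                                   ∎
    where
    open ≡-Reasoning
    dᵢ = d (lookup x i) (lookup y i)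
    y[i]≔xᵢ≡x : y [ i ]≔ lookup x i ≡ x
    y[i]≔xᵢ≡x = agreeOff⇒[]≔-lookup i y x (λ j j≢i → sym (x≈y j j≢i))

module Distance (K : Graph) (complete : ∀ v → v ∈ Graph.verts K) where
  open Graph K

  firstReach : V → V → ℕ → ℕ → ℕ
  firstReach u v k zero    = k
  firstReach u v k (suc f) = if reach K k u v then k else firstReach u v (suc k) f

  firstReach-unique : ∀ u v (s : ℕ → ℕ → ℕ) → (∀ k → s k 0 ≡ k) →
    (∀ k f → s k (suc f) ≡ (if reach K k u v then k else s (suc k) f)) →
    ∀ k f → s k f ≡ firstReach u v k f
  firstReach-unique u v s s₀ sₛ k zero    = s₀ k
  firstReach-unique u v s s₀ sₛ k (suc f)
    rewrite sₛ k f | firstReach-unique u v s s₀ sₛ (suc k) f = refl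

  -- The search defining `dist` is private to Defs; abstracting its fuel and
  -- start index lets unification instantiate `s` above with it.
  dist≡firstReach : ∀ u v → dist K u v ≡ firstReach u v 0 (length verts)
  dist≡firstReach u v with firstReach-unique u v _ (λ _ → refl) (λ _ _ → refl) | length verts
  ... | unique | f with 0
  ...   | k = unique k f

  reach-suc : ∀ k u v → T (reach K k u v) → T (reach K (suc k) u v)
  reach-suc k u v r = from T-∨ (inj₁ r)

  reach-mono : ∀ {j k} u v → j ≤ k → T (reach K j u v) → T (reach K k u v)
  reach-mono {j} u v j≤k r = go (≤⇒≤′ j≤k)
    where
    go : ∀ {k} → j ≤′ k → T (reach K k u v)
    go ≤′-refl        = r
    go {suc k} (≤′-step j≤′k) = reach-suc k u v (go j≤′k)

  walk⇒reach : ∀ {u v j} → Walk K u v j → T (reach K j u v)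
  walk⇒reach here = fromWitness refl
  walk⇒reach (step {v = v} g e) =
    from T-∨ (inj₂ (any⁺ _ (lose (complete v) (from T-∧ (walk⇒reach g , from T-≡ e)))))

  reach⇒walk : ∀ k u v → T (reach K k u v) → ∃ λ j → j ≤ k × Walk K u v j
  reach⇒walk zero u v r with refl ← toWitness r = 0 , z≤n , here
  reach⇒walk (suc k) u v r with to T-∨ r
  ... | inj₁ r′ with j , j≤k , g ← reach⇒walk k u v r′ = j , m≤n⇒m≤1+n j≤k , g
  ... | inj₂ r′ with x , rx ← satisfied (any⁻ _ verts r′) with to T-∧ rx
  ...   | ux , xv with j , j≤k , g ← reach⇒walk k u x ux = suc j , s≤s j≤k , step g (to T-≡ xv)

  firstReach-≤ : ∀ {u v j} → T (reach K j u v) → ∀ k f → k ≤ j → firstReach u v k f ≤ j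
  firstReach-≤ r k zero k≤j = k≤j
  firstReach-≤ {u} {v} r k (suc f) k≤j with reach K k u v in rk
  ... | true  = k≤j
  ... | false with m≤n⇒m<n∨m≡n k≤j
  ...   | inj₁ k<j  = firstReach-≤ r (suc k) f k<j
  ...   | inj₂ refl = ⊥-elim (subst T rk r)

  reach-firstReach : ∀ {u v} k f → T (reach K (k + f) u v) → T (reach K (firstReach u v k f) u v)
  reach-firstReach {u} {v} k zero r = subst (λ t → T (reach K t u v)) (+-identityʳ k) r
  reach-firstReach {u} {v} k (suc f) r with reach K k u v in rk
  ... | true  = subst T (sym rk) _
  ... | false = reach-firstReach (suc k) f (subst (λ t → T (reach K t u v)) (+-suc k f) r)

  module _ (u : V) where

    Stable : ℕ → Set
    Stable k = ∀ x → reach K k u x ≡ reach K (suc k) u x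

    stable-suc : ∀ {k} → Stable k → Stable (suc k)
    stable-suc st x = cong₂ _∨_ (st x) (cong or (map-cong (λ w → cong (_∧ adj w x) (st w)) verts))

    stable-≤′ : ∀ {k j} → Stable k → k ≤′ j → Stable j
    stable-≤′ st ≤′-refl         = st
    stable-≤′ st (≤′-step {j} k≤′j) = stable-suc {j} (stable-≤′ st k≤′j)

    reach-stable : ∀ {k j} → Stable k → k ≤′ j → ∀ x → reach K k u x ≡ reach K j u x
    reach-stable st ≤′-refl         x = refl
    reach-stable st (≤′-step k≤′j) x = trans (reach-stable st k≤′j x) (stable-≤′ st k≤′j x)

    -- Balls around u grow strictly until they stabilise; they start with one
    -- vertex and never exceed |V|, so they stabilise within |V| steps.
    stabilises-by : ∀ k → (∃ λ k′ → k′ ≤ k × Stable k′) ⊎ suc k ≤ countᵇ (reach K k u) verts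
    stabilises-by zero = inj₂ (countᵇ-pos (reach K 0 u) (complete u) (walk⇒reach here))
    stabilises-by (suc k) with stabilises-by k
    ... | inj₁ (k′ , k′≤k , st) = inj₁ (k′ , m≤n⇒m≤1+n k′≤k , st)
    ... | inj₂ size with countᵇ-grows verts (reach-suc k u)
    ...   | inj₁ same = inj₁ (k , n≤1+n k , λ x → All.lookup same (complete x))
    ...   | inj₂ grows = inj₂ (<-≤-trans (s≤s size) grows)

    stabilises : ∃ λ k → k ≤ length verts × Stable k
    stabilises with stabilises-by (length verts)
    ... | inj₁ stable = stable
    ... | inj₂ size = ⊥-elim (<⇒≱ size (countᵇ-≤-length (reach K (length verts) u) verts))

    reach-length : ∀ {j} v → T (reach K j u v) → T (reach K (length verts) u v)
    reach-length {j} v r with stabilises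
    ... | k , k≤N , st = reach-mono u v k≤N (reach-k (j ≤? k))
      where
      reach-k : Dec (j ≤ k) → T (reach K k u v)
      reach-k (yes j≤k) = reach-mono {j} u v j≤k r
      reach-k (no j≰k)  = subst T (sym (reach-stable st (≤⇒≤′ (≰⇒≥ j≰k)) v)) r

  dist-≤-walk : ∀ {u v j} → Walk K u v j → dist K u v ≤ j
  dist-≤-walk {u} {v} g rewrite dist≡firstReach u v = firstReach-≤ (walk⇒reach g) 0 (length verts) z≤n

  reach-dist : ∀ {j} u v → T (reach K j u v) → T (reach K (dist K u v) u v)
  reach-dist {j} u v r rewrite dist≡firstReach u v =
    reach-firstReach 0 (length verts) (reach-length u {j} v r)

  shortest-walk : ∀ {u v j} → Walk K u v j → Walk K u v (dist K u v)
  shortest-walk {u} {v} {j} g with reach⇒walk (dist K u v) u v (reach-dist {j} u v (walk⇒reach g))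
  ... | j′ , j′≤d , g′ = subst (Walk K u v) (≤-antisym j′≤d (dist-≤-walk g′)) g′

module Walks (K : Graph) where
  open Graph K

  Visits : ∀ {u v k} → Walk K u v k → V → Set
  Visits {u} here             x = x ≡ u
  Visits (step {w = w} g _) x = Visits g x ⊎ x ≡ w

  visits-end : ∀ {u v k} (g : Walk K u v k) → Visits g v
  visits-end here       = refl
  visits-end (step g e) = inj₂ refl

  _++ᵂ_ : ∀ {u v w j k} → Walk K u v j → Walk K v w k → Walk K u w (k + j)
  g ++ᵂ here     = g
  g ++ᵂ step h e = step (g ++ᵂ h) e

  visits-++ˡ : ∀ {u v w j k} (g : Walk K u v j) (h : Walk K v w k) {x} → Visits g x → Visits (g ++ᵂ h) x
  visits-++ˡ g here       gx = gx
  visits-++ˡ g (step h e) gx = inj₁ (visits-++ˡ g h gx)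

  visits-++ʳ : ∀ {u v w j k} (g : Walk K u v j) (h : Walk K v w k) {x} → Visits h x → Visits (g ++ᵂ h) x
  visits-++ʳ g here       refl       = visits-end g
  visits-++ʳ g (step h e) (inj₁ hx)  = inj₁ (visits-++ʳ g h hx)
  visits-++ʳ g (step h e) (inj₂ x≡w) = inj₂ x≡w

  walk-through : IsConnected K → ∀ (xs : List V) u v → ∃ λ k → Σ (Walk K u v k) λ g → All (Visits g) xs
  walk-through conn [] u v with k , g ← conn u v = k , g , []
  walk-through conn (x ∷ xs) u v with conn u x | walk-through conn xs x v
  ... | j , g | k , h , hxs =
    k + j , g ++ᵂ h , visits-++ˡ g h (visits-end g) ∷ All.map (visits-++ʳ g h) hxs

allVecs-suc : ∀ n m → allVecs (suc n) m ≡ cartesianProductWith _∷_ (allFin m) (allVecs n m)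
allVecs-suc n m = concatMap-map≡cartesianProductWith _∷_ (allFin m) (allVecs n m)

allVecs-complete : ∀ {n m} (x : Vec (Fin m) n) → x ∈ allVecs n m
allVecs-complete []               = here refl
allVecs-complete {suc n} {m} (a ∷ x) =
  subst (a ∷ x ∈_) (sym (allVecs-suc n m)) (∈-cartesianProductWith⁺ _∷_ (∈-allFin a) (allVecs-complete x))

wreath-complete : ∀ {n m} (G : FinGraph n) (H : FinGraph m) v → v ∈ Graph.verts (wreath G H)
wreath-complete G H (x , l) = ∈-cartesianProduct⁺ (allVecs-complete x) (∈-allFin l)

countᵇ-lookup-cong : ∀ {m} n (i : Fin n) {q q′ : Fin m → Bool} →
  countᵇ q (allFin m) ≡ countᵇ q′ (allFin m) →
  countᵇ (λ x → q (lookup x i)) (allVecs n m) ≡ countᵇ (λ x → q′ (lookup x i)) (allVecs n m)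
countᵇ-lookup-cong {m} (suc n) i {q} {q′} same = begin
  countᵇ (λ x → q (lookup x i)) (allVecs (suc n) m)   ≡⟨ cong (countᵇ _) (allVecs-suc n m) ⟩
  countᵇ (λ x → q (lookup x i)) vecs                  ≡⟨ by-coordinate i ⟩
  countᵇ (λ x → q′ (lookup x i)) vecs                 ≡⟨ cong (countᵇ _) (allVecs-suc n m) ⟨
  countᵇ (λ x → q′ (lookup x i)) (allVecs (suc n) m)  ∎
  where
  open ≡-Reasoning
  vecs = cartesianProductWith _∷_ (allFin m) (allVecs n m)
  by-coordinate : ∀ i → countᵇ (λ x → q (lookup x i)) vecs ≡ countᵇ (λ x → q′ (lookup x i)) vecs
  by-coordinate zero = begin
    countᵇ (λ x → q (lookup x zero)) vecs
      ≡⟨ countᵇ-cartesianProductWith-fst _∷_ _ q (allFin m) (allVecs n m) (λ _ _ → refl) ⟩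
    countᵇ q (allFin m) * length (allVecs n m)
      ≡⟨ cong (_* length (allVecs n m)) same ⟩
    countᵇ q′ (allFin m) * length (allVecs n m)
      ≡⟨ countᵇ-cartesianProductWith-fst _∷_ _ q′ (allFin m) (allVecs n m) (λ _ _ → refl) ⟨
    countᵇ (λ x → q′ (lookup x zero)) vecs ∎
  by-coordinate (suc i) = begin
    countᵇ (λ x → q (lookup x (suc i))) vecs
      ≡⟨ countᵇ-cartesianProductWith-snd _∷_ _ _ (allFin m) (allVecs n m) (λ _ _ → refl) ⟩
    m′ * countᵇ (λ x → q (lookup x i)) (allVecs n m)
      ≡⟨ cong (m′ *_) (countᵇ-lookup-cong n i same) ⟩
    m′ * countᵇ (λ x → q′ (lookup x i)) (allVecs n m)
      ≡⟨ countᵇ-cartesianProductWith-snd _∷_ _ _ (allFin m) (allVecs n m) (λ _ _ → refl) ⟨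
    countᵇ (λ x → q′ (lookup x (suc i))) vecs ∎
    where m′ = length (allFin m)

module Wreath {n m : ℕ} (G : FinGraph n) (H : FinGraph m) where
  open FinGraph G renaming (adjF to adjG)
  open FinGraph H renaming (adjF to adjH)
  open Graph (wreath G H) using (adj)
  open Walks (toGraph G) using (Visits; visits-end; walk-through)
  open Walks (wreath G H) using (_++ᵂ_)

  data Edge : Vec (Fin m) n × Fin n → Vec (Fin m) n × Fin n → Set where
    fibre : ∀ {y i b} → adjH (lookup y i) b ≡ true → Edge (y , i) (y [ i ]≔ b , i)
    base  : ∀ {y i k} → adjG i k ≡ true → Edge (y , i) (y , k)

  private
    base-edge : ∀ {y y′ i k} → ⌊ ≡-dec _≟_ y y′ ⌋ ∧ adjG i k ≡ true → Edge (y , i) (y′ , k)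
    base-edge {y} {y′} e with ≡-dec _≟_ y y′
    ... | yes refl = base e
    base-edge () | no _

  adj⇒edge : ∀ {u v} → adj u v ≡ true → Edge u v
  adj⇒edge {y , i} {y′ , k} e
    with i ≟ k | ≡-dec _≟_ y′ (y [ i ]≔ lookup y′ i) | adjH (lookup y i) (lookup y′ i) in eH
  ... | yes refl | yes y′≡ | true  = subst (λ z → Edge (y , i) (z , i)) (sym y′≡) (fibre eH)
  ... | yes refl | yes _   | false = base-edge e
  ... | yes refl | no _    | _     = base-edge e
  ... | no _     | _       | _     = base-edge e

  edge⇒adj : ∀ {u v} → Edge u v → adj u v ≡ true
  edge⇒adj (fibre {y} {i} {b} eH) with i ≟ i | ≡-dec _≟_ (y [ i ]≔ b) (y [ i ]≔ lookup (y [ i ]≔ b) i)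
  ... | yes _   | yes _ rewrite lookup∘update i y b | eH = refl
  ... | no i≢i  | _     = ⊥-elim (i≢i refl)
  ... | yes _   | no ne = ⊥-elim (ne (cong (y [ i ]≔_) (sym (lookup∘update i y b))))
  edge⇒adj (base {y} eG) with ≡-dec _≟_ y y
  ... | yes _ rewrite eG = ∨-zeroʳ _
  ... | no y≢y = ⊥-elim (y≢y refl)

  Covers : ∀ {l i a} → Walk (toGraph G) l i a → Vec (Fin m) n → Vec (Fin m) n → Set
  Covers g x y = ∀ j → lookup x j ≢ lookup y j → Visits g j

  module FibreMetric (connH : IsConnected (toGraph H)) where
    private
      module DH = Distance (toGraph H) ∈-allFin

    dH : Fin m → Fin m → ℕ
    dH = dist (toGraph H)

    dH-refl : ∀ a → dH a a ≡ 0
    dH-refl a = n≤0⇒n≡0 (DH.dist-≤-walk {a} here)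

    geodesicH : ∀ a b → Walk (toGraph H) a b (dH a b)
    geodesicH a b = DH.shortest-walk (proj₂ (connH a b))

    dH-step : ∀ a {b c} → adjH b c ≡ true → dH a c ≤ suc (dH a b)
    dH-step a {b} e = DH.dist-≤-walk (step (geodesicH a b) e)

    open SumDist dH dH-refl public

    sumDist-step : ∀ (x y : Vec (Fin m) n) i {b} → adjH (lookup y i) b ≡ true →
      sumDist x (y [ i ]≔ b) ≤ suc (sumDist x y)
    sumDist-step x y i {b} e = begin
      sumDist x (y [ i ]≔ b)                          ≡⟨ sumDist-[]≔ x y i b ⟩
      E + dH (lookup x i) b                           ≤⟨ +-monoʳ-≤ E (dH-step (lookup x i) e) ⟩
      E + suc (dH (lookup x i) (lookup y i))          ≡⟨ +-suc E _ ⟩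
      suc (E + dH (lookup x i) (lookup y i))          ≡⟨ cong suc (sym (sumDist-split x y i)) ⟩
      suc (sumDist x y)                               ∎
      where
      open ≤-Reasoning
      E = sumDist x (y [ i ]≔ lookup x i)

    fibre-walk : ∀ {b k} y i → Walk (toGraph H) (lookup y i) b k → Walk (wreath G H) (y , i) (y [ i ]≔ b , i) k
    fibre-walk y i here = subst (λ z → Walk (wreath G H) (y , i) (z , i) 0) (sym ([]≔-lookup y i)) here
    fibre-walk y i (step {v = c} {w = b} {k} h e) =
      subst (λ z → Walk (wreath G H) (y , i) (z , i) (suc k)) ([]≔-idempotent y i)
        (step (fibre-walk y i h) (edge⇒adj (fibre {y [ i ]≔ c} {i} {b} yᵢ~b)))
      where
      yᵢ~b : adjH (lookup (y [ i ]≔ c) i) b ≡ true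
      yᵢ~b = subst (λ a → adjH a b ≡ true) (sym (lookup∘update i y c)) e

    fibre-geodesic : ∀ x y i → AgreeOff i x y → Walk (wreath G H) (x , i) (y , i) (dH (lookup x i) (lookup y i))
    fibre-geodesic x y i x≈y =
      subst (λ z → Walk (wreath G H) (x , i) (z , i) (dH (lookup x i) (lookup y i))) (agreeOff⇒[]≔-lookup i x y x≈y)
        (fibre-walk x i (geodesicH (lookup x i) (lookup y i)))

    covering⇒walk : ∀ {l i a} (g : Walk (toGraph G) l i a) x y → Covers g x y →
      Walk (wreath G H) (x , l) (y , i) (a + sumDist x y)
    covering⇒walk {l} here x y cov =
      subst (Walk (wreath G H) (x , l) (y , l)) (sym (sumDist-agreeOff x y l x≈y)) (fibre-geodesic x y l x≈y)
      where
      x≈y : AgreeOff l x y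
      x≈y j j≢l = decidable-stable (lookup x j ≟ lookup y j) (λ xⱼ≢yⱼ → j≢l (cov j xⱼ≢yⱼ))
    covering⇒walk {l} {i} {suc a} (step {v = p} g e) x y cov =
      subst (Walk (wreath G H) (x , l) (y , i)) length-≡
        (step (covering⇒walk g x y′ cov′) (edge⇒adj (base e)) ++ᵂ fibre-geodesic y′ y i y′≈y)
      where
      -- Coordinate i is corrected last, in the fibre over the final base vertex i.
      y′ = y [ i ]≔ lookup x i
      y′≈y : AgreeOff i y′ y
      y′≈y j j≢i = lookup∘update′ j≢i y (lookup x i)
      cov′ : Covers g x y′
      cov′ j xⱼ≢y′ⱼ with j ≟ i
      ... | yes refl = ⊥-elim (xⱼ≢y′ⱼ (sym (lookup∘update i y (lookup x i))))
      ... | no j≢i with cov j (λ xⱼ≡yⱼ → xⱼ≢y′ⱼ (trans xⱼ≡yⱼ (sym (y′≈y j j≢i))))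
      ...   | inj₁ visited = visited
      ...   | inj₂ j≡i     = ⊥-elim (j≢i j≡i)
      length-≡ : dH (lookup y′ i) (lookup y i) + suc (a + sumDist x y′) ≡ suc a + sumDist x y
      length-≡ = begin
        dH (lookup y′ i) (lookup y i) + suc (a + s′) ≡⟨ cong (λ c → dH c (lookup y i) + suc (a + s′)) y′ᵢ≡xᵢ ⟩
        δ + suc (a + s′)                             ≡⟨ +-suc δ (a + s′) ⟩
        suc (δ + (a + s′))                           ≡⟨ cong suc (+-comm δ (a + s′)) ⟩
        suc (a + s′ + δ)                             ≡⟨ cong suc (+-assoc a s′ δ) ⟩
        suc a + (s′ + δ)                             ≡⟨ cong (suc a +_) (sumDist-split x y i) ⟨
        suc a + sumDist x y                          ∎
        where
        open ≡-Reasoning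
        s′ = sumDist x y′
        δ  = dH (lookup x i) (lookup y i)
        y′ᵢ≡xᵢ = lookup∘update i y (lookup x i)

    walk⇒covering : ∀ {x l y i L} → Walk (wreath G H) (x , l) (y , i) L →
      ∃ λ a → Σ (Walk (toGraph G) l i a) λ g → Covers g x y × a + sumDist x y ≤ L
    walk⇒covering {x} here = 0 , here , (λ j xⱼ≢xⱼ → ⊥-elim (xⱼ≢xⱼ refl)) , ≤-reflexive (sumDist-refl x)
    walk⇒covering {x} {y = y} {i} (step {v = x′ , p} h e) with walk⇒covering h | adj⇒edge {x′ , p} {y , i} e
    ... | a , g , cov , a+s≤L | base eG = suc a , step g eG , (λ j → inj₁ ∘ cov j) , s≤s a+s≤L
    ... | a , g , cov , a+s≤L | fibre {b = b} eH = a , g , cov′ , (begin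
      a + sumDist x (x′ [ p ]≔ b)  ≤⟨ +-monoʳ-≤ a (sumDist-step x x′ p eH) ⟩
      a + suc (sumDist x x′)       ≡⟨ +-suc a _ ⟩
      suc (a + sumDist x x′)       ≤⟨ s≤s a+s≤L ⟩
      suc _                        ∎)
      where
      open ≤-Reasoning
      cov′ : Covers g x (x′ [ p ]≔ b)
      cov′ j xⱼ≢yⱼ with j ≟ p
      ... | yes refl = visits-end g
      ... | no j≢p   = cov j (λ xⱼ≡x′ⱼ → xⱼ≢yⱼ (trans xⱼ≡x′ⱼ (sym (lookup∘update′ j≢p x′ b))))

    wreath-connected : IsConnected (toGraph G) → IsConnected (wreath G H)
    wreath-connected connG (x , l) (y , i) with walk-through connG (allFin n) l i
    ... | a , g , visits-all =
      a + sumDist x y , covering⇒walk g x y (λ j _ → All.lookup visits-all (∈-allFin j))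

module Comparison {n m : ℕ} (G : FinGraph n) (connG : IsConnected (toGraph G)) where

  module Over (H : FinGraph m) (connH : IsConnected (toGraph H)) where
    open Wreath G H public
    open FibreMetric connH public
    open Distance (wreath G H) (wreath-complete G H) public

    geodesic : ∀ u v → Walk (wreath G H) u v (dist (wreath G H) u v)
    geodesic u v = shortest-walk (proj₂ (wreath-connected connG u v))

  module Between (H₁ H₂ : FinGraph m) (c₁ : IsConnected (toGraph H₁)) (c₂ : IsConnected (toGraph H₂)) where
    private
      module O₁ = Over H₁ c₁
      module O₂ = Over H₂ c₂

    -- A geodesic to (y , i) in G ≀ H₁ projects to a base walk that also serves
    -- as the tour of a walk to (y′ , i) in G ≀ H₂.
    dist-shift : ∀ x l y y′ i → AgreeOff i y y′ →
      dist (wreath G H₂) (x , l) (y′ , i) + O₁.sumDist x y ≤ dist (wreath G H₁) (x , l) (y , i) + O₂.sumDist x y′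
    dist-shift x l y y′ i y≈y′ with O₁.walk⇒covering (O₁.geodesic (x , l) (y , i))
    ... | a , g , cov , a+s₁≤d₁ = begin
      dist (wreath G H₂) (x , l) (y′ , i) + s₁  ≤⟨ +-monoˡ-≤ s₁ (O₂.dist-≤-walk (O₂.covering⇒walk g x y′ cov′)) ⟩
      a + s₂ + s₁                               ≡⟨ xy∙z≈xz∙y a s₂ s₁ ⟩
      a + s₁ + s₂                               ≤⟨ +-monoˡ-≤ s₂ a+s₁≤d₁ ⟩
      dist (wreath G H₁) (x , l) (y , i) + s₂   ∎
      where
      open ≤-Reasoning
      s₁ = O₁.sumDist x y
      s₂ = O₂.sumDist x y′
      cov′ : O₁.Covers g x y′
      cov′ j xⱼ≢y′ⱼ with j ≟ i
      ... | yes refl = Walks.visits-end (toGraph G) g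
      ... | no j≢i   = cov j (λ xⱼ≡yⱼ → xⱼ≢y′ⱼ (trans xⱼ≡yⱼ (y≈y′ j j≢i)))

  module _ (H₁ H₂ : FinGraph m) (c₁ : IsConnected (toGraph H₁)) (c₂ : IsConnected (toGraph H₂)) where
    private
      module O₁ = Over H₁ c₁
      module O₂ = Over H₂ c₂

    dist-offset : ∀ x l y i →
      dist (wreath G H₁) (x , l) (y , i) + O₂.sumDist x y ≡ dist (wreath G H₂) (x , l) (y , i) + O₁.sumDist x y
    dist-offset x l y i = ≤-antisym (Between.dist-shift H₂ H₁ c₂ c₁ x l y y i (λ _ _ → refl))
                                    (Between.dist-shift H₁ H₂ c₁ c₂ x l y y i (λ _ _ → refl))

    base-comparison : ∀ x l y i k →
      (dist (wreath G H₁) (x , l) (y , i) <ᵇ dist (wreath G H₁) (x , l) (y , k)) ≡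
      (dist (wreath G H₂) (x , l) (y , i) <ᵇ dist (wreath G H₂) (x , l) (y , k))
    base-comparison x l y i k =
      <ᵇ-cong _ _ _ _ (<-offset (O₁.sumDist x y) (O₂.sumDist x y) (dist-offset x l y i) (dist-offset x l y k))

  module _ (H : FinGraph m) (connH : IsConnected (toGraph H)) where
    open Over H connH

    dist-fibre : ∀ x l y i b →
      dist (wreath G H) (x , l) (y , i) + dH (lookup x i) b ≡
      dist (wreath G H) (x , l) (y [ i ]≔ b , i) + dH (lookup x i) (lookup y i)
    dist-fibre x l y i b = +-cancelˡ-≡ E _ _ (begin
      E + (d + dH (lookup x i) b)            ≡⟨ x∙yz≈y∙xz E d _ ⟩
      d + (E + dH (lookup x i) b)            ≡⟨ cong (d +_) (sumDist-[]≔ x y i b) ⟨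
      d + sumDist x y′                       ≡⟨ ≤-antisym (Between.dist-shift H H connH connH x l y′ y i y′≈y)
                                                          (Between.dist-shift H H connH connH x l y y′ i y≈y′) ⟩
      d′ + sumDist x y                       ≡⟨ cong (d′ +_) (sumDist-split x y i) ⟩
      d′ + (E + dH (lookup x i) (lookup y i)) ≡⟨ x∙yz≈y∙xz d′ E _ ⟩
      E + (d′ + dH (lookup x i) (lookup y i)) ∎)
      where
      open ≡-Reasoning
      y′ = y [ i ]≔ b
      d  = dist (wreath G H) (x , l) (y , i)
      d′ = dist (wreath G H) (x , l) (y′ , i)
      E  = sumDist x (y [ i ]≔ lookup x i)
      y≈y′ : AgreeOff i y y′
      y≈y′ = agreeOff-[]≔ i y b
      y′≈y : AgreeOff i y′ y
      y′≈y j j≢i = sym (y≈y′ j j≢i)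

    fibre-comparison : ∀ x l y i b →
      (dist (wreath G H) (x , l) (y , i) <ᵇ dist (wreath G H) (x , l) (y [ i ]≔ b , i)) ≡
      (dH (lookup x i) (lookup y i) <ᵇ dH (lookup x i) b)
    fibre-comparison x l y i b = <ᵇ-cong _ _ (dH (lookup x i) (lookup y i)) (dH (lookup x i) b)
      (<-exchange (dist-fibre x l y i b))

    fibre-comparison′ : ∀ x l y i b →
      (dist (wreath G H) (x , l) (y [ i ]≔ b , i) <ᵇ dist (wreath G H) (x , l) (y , i)) ≡
      (dH (lookup x i) b <ᵇ dH (lookup x i) (lookup y i))
    fibre-comparison′ x l y i b = <ᵇ-cong _ _ (dH (lookup x i) b) (dH (lookup x i) (lookup y i))
      (<-exchange (sym (dist-fibre x l y i b)))

    fibre-balanced : DistanceBalanced (toGraph H) → ∀ y i {b} → FinGraph.adjF H (lookup y i) b ≡ true →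
      count (wreath G H) (λ z → dist (wreath G H) z (y , i) <ᵇ dist (wreath G H) z (y [ i ]≔ b , i)) ≡
      count (wreath G H) (λ z → dist (wreath G H) z (y [ i ]≔ b , i) <ᵇ dist (wreath G H) z (y , i))
    fibre-balanced balancedH y i {b} e = begin
      count (wreath G H) _
        ≡⟨ countᵇ-cong vertices (λ { (x , l) → fibre-comparison x l y i b }) ⟩
      countᵇ (λ z → closer (lookup (proj₁ z) i)) vertices
        ≡⟨ countᵇ-cartesianProductWith-fst _,_ _ _ (allVecs n m) (allFin n) (λ _ _ → refl) ⟩
      countᵇ (λ x → closer (lookup x i)) (allVecs n m) * length (allFin n)
        ≡⟨ cong (_* length (allFin n)) (countᵇ-lookup-cong n i (balancedH (lookup y i) b e)) ⟩
      countᵇ (λ x → farther (lookup x i)) (allVecs n m) * length (allFin n)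
        ≡⟨ countᵇ-cartesianProductWith-fst _,_ _ _ (allVecs n m) (allFin n) (λ _ _ → refl) ⟨
      countᵇ (λ z → farther (lookup (proj₁ z) i)) vertices
        ≡⟨ countᵇ-cong vertices (λ { (x , l) → fibre-comparison′ x l y i b }) ⟨
      count (wreath G H) _ ∎
      where
      open ≡-Reasoning
      vertices = Graph.verts (wreath G H)
      closer farther : Fin m → Bool
      closer  a = dH a (lookup y i) <ᵇ dH a b
      farther a = dH a b <ᵇ dH a (lookup y i)

  balanced-transfer : ∀ {H₁ H₂} (c₁ : IsConnected (toGraph H₁)) (c₂ : IsConnected (toGraph H₂)) →
    DistanceBalanced (wreath G H₁) → DistanceBalanced (toGraph H₂) → DistanceBalanced (wreath G H₂)
  balanced-transfer {H₁} {H₂} c₁ c₂ balanced₁ balancedH₂ u v e with Wreath.adj⇒edge G H₂ {u} {v} e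
  ... | Wreath.fibre eH = fibre-balanced H₂ c₂ balancedH₂ _ _ eH
  ... | Wreath.base {y} {i} {k} eG = begin
    count (wreath G H₂) (λ z → dist (wreath G H₂) z (y , i) <ᵇ dist (wreath G H₂) z (y , k))
      ≡⟨ countᵇ-cong vertices (λ { (x , l) → base-comparison H₁ H₂ c₁ c₂ x l y i k }) ⟨
    count (wreath G H₁) (λ z → dist (wreath G H₁) z (y , i) <ᵇ dist (wreath G H₁) z (y , k))
      ≡⟨ balanced₁ (y , i) (y , k) (Wreath.edge⇒adj G H₁ (Wreath.base eG)) ⟩
    count (wreath G H₁) (λ z → dist (wreath G H₁) z (y , k) <ᵇ dist (wreath G H₁) z (y , i))
      ≡⟨ countᵇ-cong vertices (λ { (x , l) → base-comparison H₁ H₂ c₁ c₂ x l y k i }) ⟩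
    count (wreath G H₂) (λ z → dist (wreath G H₂) z (y , k) <ᵇ dist (wreath G H₂) z (y , i)) ∎
    where
    open ≡-Reasoning
    vertices = Graph.verts (wreath G H₁)

corollary3p5 : ∀ {n m} (G : FinGraph n) (H H' : FinGraph m) →
    IsSimple (toGraph G) → IsConnected (toGraph G) →
    IsSimple (toGraph H) → IsConnected (toGraph H) → DistanceBalanced (toGraph H) →
    IsSimple (toGraph H') → IsConnected (toGraph H') → DistanceBalanced (toGraph H') →
    DistanceBalanced (wreath G H) ⇔ DistanceBalanced (wreath G H')
corollary3p5 G H H' _ connG _ connH balancedH _ connH' balancedH' =
  mk⇔ (λ balanced → balanced-transfer connH connH' balanced balancedH')
      (λ balanced′ → balanced-transfer connH' connH balanced′ balancedH)
  where open Comparison G connG
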